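{- For each $v\in\{49,61,73,97,121\}$ there exists a super-simple $(v,4,2)$DD with $d\ge\frac12$.
   Context: A $(v,4,2)$DD is a pair $(X,\mathcal{B})$ with $|X|=v$ and $\mathcal{B}$ a collection of ordered $4$-tuples of distinct points (blocks) such that every ordered pair $(x,y)$ of distinct points appears in exactly $2$ blocks, where $(x,y)$ appears in $(a_1,\dots,a_4)$ if $x=a_i,y=a_j$ with $i<j$. It is super-simple if any two blocks, viewed as sets, share at most two points. A defining set is a subset of $\mathcal{B}$ contained in a unique $(v,4,2)$DD on $X$; $d$ is the size of a smallest defining set divided by $|\mathcal{B}|$. -}

module Defs where

open import Data.Nat using (ℕ; _≤_; _*_)
open import Data.Fin using (Fin) renaming (_≟_ to _≟ᶠ_)
open import Data.Fin.Subset using (Subset; _∈_; ∣_∣)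
open import Data.Vec using (Vec; []; _∷_; lookup; toList)
open import Data.List using (List; []; _∷_; length; filter)
import Data.List as L
open import Data.List.Membership.DecPropositional using () renaming (_∈?_ to mem?)
import Data.List.Membership.Propositional as LM
open import Data.List.Relation.Unary.All using (All)
open import Data.List.Relation.Binary.Permutation.Propositional using (_↭_)
open import Data.Product using (_×_; _,_)
open import Data.Product.Properties using (≡-dec)
open import Relation.Binary.PropositionalEquality using (_≡_; _≢_)

Block : ℕ → Set
Block v = Vec (Fin v) 4

DistinctPoints : ∀ {v} → Block v → Set
DistinctPoints b = ∀ i j → i ≢ j → lookup b i ≢ lookup b j

orderedPairs : ∀ {v} → Block v → List (Fin v × Fin v)
orderedPairs (a ∷ b ∷ c ∷ d ∷ []) =
  (a , b) ∷ (a , c) ∷ (a , d) ∷ (b , c) ∷ (b , d) ∷ (c , d) ∷ []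

pairCount : ∀ {v} → Fin v → Fin v → List (Block v) → ℕ
pairCount {v} x y ℬ =
  length (filter (λ b → mem? (≡-dec _≟ᶠ_ _≟ᶠ_) (x , y) (orderedPairs b)) ℬ)

-- (v,4,2) directed design on X = Fin v, blocks as a list (multiset).
IsDD : (v : ℕ) → List (Block v) → Set
IsDD v ℬ = All DistinctPoints ℬ
         × (∀ (x y : Fin v) → x ≢ y → pairCount x y ℬ ≡ 2)

commonPoints : ∀ {v} → Block v → Block v → ℕ
commonPoints {v} b c = length (filter (λ a → mem? _≟ᶠ_ a (toList c)) (toList b))

SuperSimple : ∀ {v} → List (Block v) → Set
SuperSimple ℬ = ∀ (i j : Fin (length ℬ)) → i ≢ j →
  commonPoints (L.lookup ℬ i) (L.lookup ℬ j) ≤ 2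

IsDefiningSet : (v : ℕ) → (ℬ : List (Block v)) → Subset (length ℬ) → Set
IsDefiningSet v ℬ S = ∀ (ℬ′ : List (Block v)) → IsDD v ℬ′ →
  (∀ i → i ∈ S → L.lookup ℬ i LM.∈ ℬ′) → ℬ′ ↭ ℬ

-- d ≥ 1/2 : every defining set has size at least |ℬ|/2
-- (equivalently, the smallest defining set does).
DefRatioAtLeastHalf : (v : ℕ) → List (Block v) → Set
DefRatioAtLeastHalf v ℬ = ∀ (S : Subset (length ℬ)) → IsDefiningSet v ℬ S →
  length ℬ ≤ 2 * ∣ S ∣

-- Each design is cyclic: its blocks are the translates X + t (t < v) modulo v of base blocks
-- that come in pairs P = (0, d, p, q), Q = (d, 0, r, s). For each t the blocks P + t, Q + t have
-- the shape (a, b, …), (b, a, …), and exchanging the first two points in both of them only moves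
-- the ordered pair (a, b) from one block to the other and (b, a) back, so it yields another
-- (v,4,2)DD. In a super-simple design the exchanged block, which has the same four points as a
-- block of the design, is not a block; hence a defining set meets each of the |ℬ|/2 pairs, i.e.
-- d ≥ 1/2. That the translates form a DD (every nonzero residue arises exactly twice as a
-- difference of an ordered pair inside a base block) and that it is super-simple (two translates
-- share a point only through a difference between their base blocks, and none of those repeats
-- more than twice) are finite conditions on the base blocks, decided by evaluation.

module Submission where

open import Defs
open import Data.Bool using (Bool; true; false; if_then_else_)
open import Data.Empty using (⊥; ⊥-elim)
open import Data.Fin as F using (Fin; toℕ; #_)
import Data.Fin.Properties as FP
open import Data.Fin.Subset as Subset using (Subset; ∣_∣)
open import Data.List as L using (List; []; _∷_; _++_; length; filter; concatMap; applyUpTo; upTo)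
import Data.List.Properties as LP
open import Data.List.Membership.Propositional using (_∈_; _∉_)
open import Data.List.Membership.Propositional.Properties using (∈-lookup; ∈-upTo⁺)
open import Data.List.Relation.Binary.Permutation.Propositional using (↭-sym)
open import Data.List.Relation.Binary.Permutation.Propositional.Properties using (∈-resp-↭; shifts)
open import Data.List.Relation.Unary.All as All using (All; []; _∷_)
import Data.List.Relation.Unary.All.Properties as AllP
open import Data.List.Relation.Unary.AllPairs as AllPairs using (AllPairs; []; _∷_)
import Data.List.Relation.Unary.AllPairs.Properties as AllPairsP
open import Data.List.Relation.Unary.Any as Any using (here; there)
open import Data.List.Relation.Unary.Any.Properties using (lookup-index)
open import Data.Nat as ℕ using (ℕ; zero; suc; _+_; _*_; _∸_; _≤_; _<_; z≤n; s≤s; NonZero; _%_)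
import Data.Nat.Properties as ℕP
open import Algebra.Properties.CommutativeSemigroup ℕP.+-commutativeSemigroup
  using (interchange; x∙yz≈y∙xz; xy∙z≈y∙xz)
open import Data.Nat.DivMod using (_mod_; %-distribˡ-+; m%n%n≡m%n; [m+n]%n≡m%n; m<n⇒m%n≡m; m%n<n)
open import Data.Product using (_×_; _,_; proj₁; proj₂; uncurry; swap; ∃-syntax)
open import Data.Product.Properties using (≡-dec)
open import Data.Sum using (_⊎_; inj₁; inj₂)
open import Data.Vec as V using (Vec; []; _∷_; lookup; toList)
import Data.Vec.Properties as VP
open import Data.Vec.Relation.Unary.All as VAll using ([]; _∷_)
import Data.Vec.Relation.Unary.All.Properties as VAllP
open import Function using (_∘_)
open import Level using (Level)
open import Relation.Binary.Bundles using (Setoid)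
import Relation.Binary.Construct.On as On
open import Relation.Binary.Definitions using (DecidableEquality)
open import Relation.Binary.PropositionalEquality
open import Relation.Nullary using (Dec; yes; no; does; ¬_; contradiction; ¬?; _→-dec_; _×-dec_)
open import Relation.Nullary.Decidable using (True; toWitness)
open import Relation.Unary using (Decidable)

-- Indicator sums and occurrence counts

private
  variable
    p q : Level
    P : Set p
    Q : Set q

𝟙 : Dec P → ℕ
𝟙 P? = if does P? then 1 else 0

𝟙-no : (P? : Dec P) → ¬ P → 𝟙 P? ≡ 0
𝟙-no (yes p) ¬p = contradiction p ¬p
𝟙-no (no _)  _  = refl

𝟙-mono : (P → Q) → (P? : Dec P) (Q? : Dec Q) → 𝟙 P? ≤ 𝟙 Q?
𝟙-mono P⇒Q (yes p) (yes _) = ℕP.≤-refl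
𝟙-mono P⇒Q (yes p) (no ¬q)  = contradiction (P⇒Q p) ¬q
𝟙-mono P⇒Q (no _)  Q?       = z≤n

𝟙-cong : (P → Q) → (Q → P) → (P? : Dec P) (Q? : Dec Q) → 𝟙 P? ≡ 𝟙 Q?
𝟙-cong P⇒Q Q⇒P P? Q? = ℕP.≤-antisym (𝟙-mono P⇒Q P? Q?) (𝟙-mono Q⇒P Q? P?)

length-filter-∷ : ∀ {a ℓ} {A : Set a} {P : A → Set ℓ} (P? : Decidable P) x xs →
  length (filter P? (x ∷ xs)) ≡ 𝟙 (P? x) + length (filter P? xs)
length-filter-∷ P? x xs with does (P? x)
... | true  = refl
... | false = refl

∑ : ℕ → (ℕ → ℕ) → ℕ
∑ zero    f = 0
∑ (suc n) f = f 0 + ∑ n (f ∘ suc)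

syntax ∑ n (λ t → e) = ∑[ t < n ] e

∑-cong : ∀ n {f g} → (∀ t → f t ≡ g t) → ∑ n f ≡ ∑ n g
∑-cong zero    f≗g = refl
∑-cong (suc n) f≗g = cong₂ _+_ (f≗g 0) (∑-cong n (f≗g ∘ suc))

∑-distrib-+ : ∀ n (f g : ℕ → ℕ) → ∑[ t < n ] (f t + g t) ≡ ∑ n f + ∑ n g
∑-distrib-+ zero    f g = refl
∑-distrib-+ (suc n) f g = trans (cong (f 0 + g 0 +_) (∑-distrib-+ n (f ∘ suc) (g ∘ suc)))
  (interchange (f 0) (g 0) (∑ n (f ∘ suc)) (∑ n (g ∘ suc)))

∑-zero : ∀ n {f} → (∀ t → t < n → f t ≡ 0) → ∑ n f ≡ 0
∑-zero zero    f≡0 = refl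
∑-zero (suc n) f≡0 = cong₂ _+_ (f≡0 0 (s≤s z≤n)) (∑-zero n (λ t t<n → f≡0 (suc t) (s≤s t<n)))

∑-single : ∀ n {f t₀} → t₀ < n → (∀ t → t < n → t ≢ t₀ → f t ≡ 0) → ∑ n f ≡ f t₀
∑-single (suc n) {f} {zero}   _           f≡0 =
  trans (cong (f 0 +_) (∑-zero n (λ t t<n → f≡0 (suc t) (s≤s t<n) λ ()))) (ℕP.+-identityʳ (f 0))
∑-single (suc n) {f} {suc t₀} (s≤s t₀<n) f≡0 =
  cong₂ _+_ (f≡0 0 (s≤s z≤n) λ ())
    (∑-single n t₀<n (λ t t<n t≢t₀ → f≡0 (suc t) (s≤s t<n) (t≢t₀ ∘ ℕP.suc-injective)))

module Occurrences {a} {A : Set a} (_≟_ : DecidableEquality A) where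

  open import Data.List.Membership.DecPropositional _≟_ using (_∈?_)

  occ : A → List A → ℕ
  occ z []      = 0
  occ z (q ∷ l) = 𝟙 (z ≟ q) + occ z l

  occ-++ : ∀ z xs ys → occ z (xs ++ ys) ≡ occ z xs + occ z ys
  occ-++ z []       ys = refl
  occ-++ z (q ∷ xs) ys = trans (cong (𝟙 (z ≟ q) +_) (occ-++ z xs ys)) (sym (ℕP.+-assoc (𝟙 (z ≟ q)) _ _))

  occ≡0⊎∈ : ∀ z l → occ z l ≡ 0 ⊎ z ∈ l
  occ≡0⊎∈ z []      = inj₁ refl
  occ≡0⊎∈ z (q ∷ l) with z ≟ q | occ≡0⊎∈ z l
  ... | yes z≡q | _        = inj₂ (here z≡q)
  ... | no  _   | inj₁ eq  = inj₁ eq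
  ... | no  _   | inj₂ z∈l = inj₂ (there z∈l)

  𝟙∈-∷ : ∀ {z q l} → (z ≡ q → z ∉ l) → 𝟙 (z ∈? q ∷ l) ≡ 𝟙 (z ≟ q) + 𝟙 (z ∈? l)
  𝟙∈-∷ {z} {q} {l} z≡q⇒z∉l with z ≟ q
  ... | yes z≡q = cong suc (sym (𝟙-no (z ∈? l) (z≡q⇒z∉l z≡q)))
  ... | no  _   = refl

  𝟙∈≤occ : ∀ z l → 𝟙 (z ∈? l) ≤ occ z l
  𝟙∈≤occ z []      = z≤n
  𝟙∈≤occ z (q ∷ l) with z ≟ q
  ... | yes _ = s≤s z≤n
  ... | no  _ = 𝟙∈≤occ z l

  𝟙∈≡occ : ∀ z {l} → AllPairs _≢_ l → 𝟙 (z ∈? l) ≡ occ z l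
  𝟙∈≡occ z {[]}    []         = refl
  𝟙∈≡occ z {q ∷ l} (q∉l ∷ ul) =
    trans (𝟙∈-∷ (λ { refl z∈l → All.lookup q∉l z∈l refl }))
          (cong (𝟙 (z ≟ q) +_) (𝟙∈≡occ z ul))

-- On blocks this is DistinctPoints; stating it for any vector lets base blocks over ℕ use it too.
Distinct : ∀ {a} {A : Set a} {n} → Vec A n → Set a
Distinct xs = ∀ i j → i ≢ j → lookup xs i ≢ lookup xs j

distinct? : ∀ {a} {A : Set a} {n} → DecidableEquality A → (xs : Vec A n) → Dec (Distinct xs)
distinct? _≟_ xs = FP.all? λ i → FP.all? λ j → ¬? (i F.≟ j) →-dec ¬? (lookup xs i ≟ lookup xs j)

-- Trades and defining sets

module Trades {v : ℕ} where

  _≟ₚ_ : DecidableEquality (Fin v × Fin v)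
  _≟ₚ_ = ≡-dec F._≟_ F._≟_

  open import Data.List.Membership.DecPropositional _≟ₚ_ using (_∈?_)

  hits : Fin v → Fin v → Block v → ℕ
  hits x y B = 𝟙 ((x , y) ∈? orderedPairs B)

  orderedPairs-unique : ∀ {B : Block v} → Distinct B → AllPairs _≢_ (orderedPairs B)
  orderedPairs-unique {a ∷ b ∷ c ∷ d ∷ []} dist =
    (snd bc ∷ snd bd ∷ fst ab ∷ fst ab ∷ fst ac ∷ []) ∷
    (snd cd ∷ fst ab ∷ fst ab ∷ fst ac ∷ []) ∷
    (fst ab ∷ fst ab ∷ fst ac ∷ []) ∷
    (snd cd ∷ fst bc ∷ []) ∷
    (fst bc ∷ []) ∷
    [] ∷ []
    where
    fst : ∀ {p q r s : Fin v} → p ≢ r → (p , q) ≢ (r , s)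
    fst p≢r = p≢r ∘ cong proj₁
    snd : ∀ {p q r s : Fin v} → q ≢ s → (p , q) ≢ (r , s)
    snd q≢s = q≢s ∘ cong proj₂
    ab = dist (F.# 0) (F.# 1) (λ ())
    ac = dist (F.# 0) (F.# 2) (λ ())
    bc = dist (F.# 1) (F.# 2) (λ ())
    bd = dist (F.# 1) (F.# 3) (λ ())
    cd = dist (F.# 2) (F.# 3) (λ ())

  pairCount-∷ : ∀ x y B ℬ → pairCount x y (B ∷ ℬ) ≡ hits x y B + pairCount x y ℬ
  pairCount-∷ x y = length-filter-∷ (λ B → (x , y) ∈? orderedPairs B)

  pairCount-++ : ∀ x y ℬ ℬ′ → pairCount x y (ℬ ++ ℬ′) ≡ pairCount x y ℬ + pairCount x y ℬ′
  pairCount-++ x y ℬ ℬ′ = trans (cong length (LP.filter-++ P? ℬ ℬ′)) (LP.length-++ (filter P? ℬ))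
    where P? = λ B → (x , y) ∈? orderedPairs B

  swap₀₁ : Block v → Block v
  swap₀₁ (a ∷ b ∷ c ∷ d ∷ []) = b ∷ a ∷ c ∷ d ∷ []

  private
    σ : Fin 4 → Fin 4
    σ F.zero            = F.suc F.zero
    σ (F.suc F.zero)    = F.zero
    σ i@(F.suc (F.suc _)) = i

    σ-involutive : ∀ i → σ (σ i) ≡ i
    σ-involutive F.zero              = refl
    σ-involutive (F.suc F.zero)      = refl
    σ-involutive (F.suc (F.suc _))   = refl

    lookup-swap₀₁ : ∀ B i → lookup (swap₀₁ B) i ≡ lookup B (σ i)
    lookup-swap₀₁ (a ∷ b ∷ c ∷ d ∷ []) F.zero                          = refl
    lookup-swap₀₁ (a ∷ b ∷ c ∷ d ∷ []) (F.suc F.zero)                  = refl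
    lookup-swap₀₁ (a ∷ b ∷ c ∷ d ∷ []) (F.suc (F.suc F.zero))          = refl
    lookup-swap₀₁ (a ∷ b ∷ c ∷ d ∷ []) (F.suc (F.suc (F.suc F.zero)))  = refl

  distinct-swap₀₁ : ∀ B → Distinct B → Distinct (swap₀₁ B)
  distinct-swap₀₁ B dist i j i≢j eq =
    dist (σ i) (σ j) (i≢j ∘ σ-injective) (trans (sym (lookup-swap₀₁ B i)) (trans eq (lookup-swap₀₁ B j)))
    where
    σ-injective : σ i ≡ σ j → i ≡ j
    σ-injective σi≡σj = trans (sym (σ-involutive i)) (trans (cong σ σi≡σj) (σ-involutive j))

  swap₀₁-≢ : ∀ {B} → Distinct B → B ≢ swap₀₁ B
  swap₀₁-≢ {a ∷ b ∷ c ∷ d ∷ []} dist eq = dist (# 0) (# 1) (λ ()) (cong V.head eq)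

  commonPoints-swap₀₁ : ∀ B → commonPoints B (swap₀₁ B) ≡ 4
  commonPoints-swap₀₁ (a ∷ b ∷ c ∷ d ∷ []) = cong length (LP.filter-all (_∈ᶠ? (b ∷ a ∷ c ∷ d ∷ []))
    (there (here refl) ∷ here refl ∷ there (there (here refl)) ∷ there (there (there (here refl))) ∷ []))
    where open import Data.List.Membership.DecPropositional (F._≟_ {v}) renaming (_∈?_ to _∈ᶠ?_)

  pairsBesides₀₁ : Fin v → Fin v → Fin v → Fin v → List (Fin v × Fin v)
  pairsBesides₀₁ a b c d = (a , c) ∷ (a , d) ∷ (b , c) ∷ (b , d) ∷ (c , d) ∷ []

  hits-split : ∀ a b c d → Distinct (a ∷ b ∷ c ∷ d ∷ []) → ∀ x y →
    hits x y (a ∷ b ∷ c ∷ d ∷ []) ≡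
    𝟙 ((x , y) ≟ₚ (a , b)) + 𝟙 ((x , y) ∈? pairsBesides₀₁ a b c d)
  hits-split a b c d dist x y =
    𝟙∈-∷ {z = x , y} {q = a , b} {l = pairsBesides₀₁ a b c d} λ { refl → leading∉ }
    where
    open Occurrences _≟ₚ_ using (𝟙∈-∷)
    leading∉ : (a , b) ∉ pairsBesides₀₁ a b c d
    leading∉ (here eq)                         = dist (# 1) (# 2) (λ ()) (cong proj₂ eq)
    leading∉ (there (here eq))                 = dist (# 1) (# 3) (λ ()) (cong proj₂ eq)
    leading∉ (there (there (here eq)))         = dist (# 0) (# 1) (λ ()) (cong proj₁ eq)
    leading∉ (there (there (there (here eq)))) = dist (# 0) (# 1) (λ ()) (cong proj₁ eq)
    leading∉ (there (there (there (there (here eq))))) = dist (# 0) (# 2) (λ ()) (cong proj₁ eq)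

  𝟙∈-pairsBesides₀₁-swap : ∀ a b c d z →
    𝟙 (z ∈? pairsBesides₀₁ b a c d) ≡ 𝟙 (z ∈? pairsBesides₀₁ a b c d)
  𝟙∈-pairsBesides₀₁-swap a b c d z =
    𝟙-cong (∈-resp-↭ π) (∈-resp-↭ (↭-sym π)) (z ∈? pairsBesides₀₁ b a c d) (z ∈? pairsBesides₀₁ a b c d)
    where π = shifts ((b , c) ∷ (b , d) ∷ []) ((a , c) ∷ (a , d) ∷ [])

  hits-trade : ∀ a b c d e f → Distinct (a ∷ b ∷ c ∷ d ∷ []) → Distinct (b ∷ a ∷ e ∷ f ∷ []) →
    ∀ x y →
    hits x y (b ∷ a ∷ c ∷ d ∷ []) + hits x y (a ∷ b ∷ e ∷ f ∷ []) ≡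
    hits x y (a ∷ b ∷ c ∷ d ∷ []) + hits x y (b ∷ a ∷ e ∷ f ∷ [])
  hits-trade a b c d e f B-dist B′-dist x y = begin
    hits x y (b ∷ a ∷ c ∷ d ∷ []) + hits x y (a ∷ b ∷ e ∷ f ∷ [])
      ≡⟨ cong₂ _+_ (hits-split b a c d (distinct-swap₀₁ (a ∷ b ∷ c ∷ d ∷ []) B-dist) x y)
                   (hits-split a b e f (distinct-swap₀₁ (b ∷ a ∷ e ∷ f ∷ []) B′-dist) x y) ⟩
    (𝟙ba + 𝟙 (z ∈? pairsBesides₀₁ b a c d)) + (𝟙ab + 𝟙 (z ∈? pairsBesides₀₁ a b e f))
      ≡⟨ cong₂ (λ m n → (𝟙ba + m) + (𝟙ab + n))
               (𝟙∈-pairsBesides₀₁-swap a b c d z) (𝟙∈-pairsBesides₀₁-swap b a e f z) ⟩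
    (𝟙ba + R) + (𝟙ab + R′)
      ≡⟨ interchange 𝟙ba R 𝟙ab R′ ⟩
    (𝟙ba + 𝟙ab) + (R + R′)
      ≡⟨ cong (_+ (R + R′)) (ℕP.+-comm 𝟙ba 𝟙ab) ⟩
    (𝟙ab + 𝟙ba) + (R + R′)
      ≡⟨ interchange 𝟙ab R 𝟙ba R′ ⟨
    (𝟙ab + R) + (𝟙ba + R′)
      ≡⟨ cong₂ _+_ (hits-split a b c d B-dist x y) (hits-split b a e f B′-dist x y) ⟨
    hits x y (a ∷ b ∷ c ∷ d ∷ []) + hits x y (b ∷ a ∷ e ∷ f ∷ []) ∎
    where
    open ≡-Reasoning
    z = (x , y)
    𝟙ab = 𝟙 (z ≟ₚ (a , b))
    𝟙ba = 𝟙 (z ≟ₚ (b , a))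
    R = 𝟙 (z ∈? pairsBesides₀₁ a b c d)
    R′ = 𝟙 (z ∈? pairsBesides₀₁ b a e f)

  Trade : Set
  Trade = Block v × Block v

  IsTrade : Trade → Set
  IsTrade ((a ∷ b ∷ _ ∷ _ ∷ []) , (b′ ∷ a′ ∷ _ ∷ _ ∷ [])) = a ≡ a′ × b ≡ b′

  blocks : List Trade → List (Block v)
  blocks = concatMap (λ (B , B′) → B ∷ B′ ∷ [])

  blocks-++ : ∀ Ts Ts′ → blocks (Ts ++ Ts′) ≡ blocks Ts ++ blocks Ts′
  blocks-++ = LP.concatMap-++ _

  all-blocks : ∀ {ℓ} {Pr : Block v → Set ℓ} {Ts} →
    All (λ (B , B′) → Pr B × Pr B′) Ts → All Pr (blocks Ts)
  all-blocks []                 = []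
  all-blocks ((pB , pB′) ∷ prs) = pB ∷ pB′ ∷ all-blocks prs

  swapTrade : Trade → Trade
  swapTrade (B , B′) = swap₀₁ B , swap₀₁ B′

  swapTradeAt : ℕ → List Trade → List Trade
  swapTradeAt _       []       = []
  swapTradeAt zero    (T ∷ Ts) = swapTrade T ∷ Ts
  swapTradeAt (suc k) (T ∷ Ts) = T ∷ swapTradeAt k Ts

  pairCount-blocks-∷ : ∀ x y B B′ Ts →
    pairCount x y (blocks ((B , B′) ∷ Ts)) ≡ (hits x y B + hits x y B′) + pairCount x y (blocks Ts)
  pairCount-blocks-∷ x y B B′ Ts = begin
    pairCount x y (B ∷ B′ ∷ blocks Ts)
      ≡⟨ pairCount-∷ x y B _ ⟩
    hits x y B + pairCount x y (B′ ∷ blocks Ts)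
      ≡⟨ cong (hits x y B +_) (pairCount-∷ x y B′ _) ⟩
    hits x y B + (hits x y B′ + pairCount x y (blocks Ts))
      ≡⟨ ℕP.+-assoc (hits x y B) _ _ ⟨
    (hits x y B + hits x y B′) + pairCount x y (blocks Ts) ∎
    where open ≡-Reasoning

  pairCount-swapTradeAt : ∀ Ts → All IsTrade Ts → All Distinct (blocks Ts) → ∀ k x y →
    pairCount x y (blocks (swapTradeAt k Ts)) ≡ pairCount x y (blocks Ts)
  pairCount-swapTradeAt [] _ _ k x y = refl
  pairCount-swapTradeAt (((a ∷ b ∷ c ∷ d ∷ []) , (.b ∷ .a ∷ e ∷ f ∷ [])) ∷ Ts) ((refl , refl) ∷ _)
    (B-dist ∷ B′-dist ∷ _) zero x y =
    trans (pairCount-blocks-∷ x y (b ∷ a ∷ c ∷ d ∷ []) (a ∷ b ∷ e ∷ f ∷ []) Ts)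
      (trans (cong (_+ pairCount x y (blocks Ts)) (hits-trade a b c d e f B-dist B′-dist x y))
        (sym (pairCount-blocks-∷ x y (a ∷ b ∷ c ∷ d ∷ []) (b ∷ a ∷ e ∷ f ∷ []) Ts)))
  pairCount-swapTradeAt ((B , B′) ∷ Ts) (_ ∷ trades) (_ ∷ _ ∷ dists) (suc k) x y =
    trans (pairCount-blocks-∷ x y B B′ (swapTradeAt k Ts))
      (trans (cong ((hits x y B + hits x y B′) +_) (pairCount-swapTradeAt Ts trades dists k x y))
        (sym (pairCount-blocks-∷ x y B B′ Ts)))

  distinct-swapTradeAt : ∀ Ts → All Distinct (blocks Ts) → ∀ k → All Distinct (blocks (swapTradeAt k Ts))
  distinct-swapTradeAt []              _                           _       = []
  distinct-swapTradeAt ((B , B′) ∷ Ts) (B-dist ∷ B′-dist ∷ dists) zero    =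
    distinct-swap₀₁ B B-dist ∷ distinct-swap₀₁ B′ B′-dist ∷ dists
  distinct-swapTradeAt ((B , B′) ∷ Ts) (B-dist ∷ B′-dist ∷ dists) (suc k) =
    B-dist ∷ B′-dist ∷ distinct-swapTradeAt Ts dists k

  isDD-swapTradeAt : ∀ Ts → All IsTrade Ts → IsDD v (blocks Ts) → ∀ k → IsDD v (blocks (swapTradeAt k Ts))
  isDD-swapTradeAt Ts trades (dists , counts) k =
    distinct-swapTradeAt Ts dists k ,
    λ x y x≢y → trans (pairCount-swapTradeAt Ts trades dists k x y) (counts x y x≢y)

  double : ℕ → ℕ
  double zero    = zero
  double (suc k) = suc (suc (double k))

  ∈-swapTradeAt : ∀ Ts k (i : Fin (length (blocks Ts))) → toℕ i ≢ double k → toℕ i ≢ suc (double k) →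
    L.lookup (blocks Ts) i ∈ blocks (swapTradeAt k Ts)
  ∈-swapTradeAt ((B , B′) ∷ Ts) zero    F.zero                   i≢0 _   = contradiction refl i≢0
  ∈-swapTradeAt ((B , B′) ∷ Ts) zero    (F.suc F.zero)           _   i≢1 = contradiction refl i≢1
  ∈-swapTradeAt ((B , B′) ∷ Ts) zero    (F.suc (F.suc i))        _   _   = there (there (∈-lookup i))
  ∈-swapTradeAt ((B , B′) ∷ Ts) (suc k) F.zero                   _   _   = here refl
  ∈-swapTradeAt ((B , B′) ∷ Ts) (suc k) (F.suc F.zero)           _   _   = there (here refl)
  ∈-swapTradeAt ((B , B′) ∷ Ts) (suc k) (F.suc (F.suc i))        i≢k i≢k′ =
    there (there (∈-swapTradeAt Ts k i (i≢k ∘ cong (suc ∘ suc)) (i≢k′ ∘ cong (suc ∘ suc))))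

  swapped-∈-swapTradeAt : ∀ Ts k → k < length Ts → All Distinct (blocks Ts) →
    ∃[ B ] (B ∈ blocks Ts × swap₀₁ B ∈ blocks (swapTradeAt k Ts) × Distinct B)
  swapped-∈-swapTradeAt ((B , B′) ∷ Ts) zero    _         (B-dist ∷ _) = B , here refl , here refl , B-dist
  swapped-∈-swapTradeAt ((B , B′) ∷ Ts) (suc k) (s≤s k<n) (_ ∷ _ ∷ dists)
    with C , C∈ , C′∈ , C-dist ← swapped-∈-swapTradeAt Ts k k<n dists =
    C , there (there C∈) , there (there C′∈) , C-dist

  superSimple⇒swap₀₁∉ : ∀ {ℬ B} → SuperSimple ℬ → B ∈ ℬ → Distinct B → swap₀₁ B ∉ ℬ
  superSimple⇒swap₀₁∉ {ℬ} {B} ss B∈ B-dist B′∈ with Any.index B∈ F.≟ Any.index B′∈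
  ... | yes i≡j = swap₀₁-≢ B-dist (begin
    B                               ≡⟨ lookup-index B∈ ⟩
    L.lookup ℬ (Any.index B∈)       ≡⟨ cong (L.lookup ℬ) i≡j ⟩
    L.lookup ℬ (Any.index B′∈)      ≡⟨ lookup-index B′∈ ⟨
    swap₀₁ B                        ∎)
    where open ≡-Reasoning
  ... | no i≢j = fourCommon≰2 (subst (_≤ 2) (commonPoints-swap₀₁ B)
    (subst₂ (λ C C′ → commonPoints C C′ ≤ 2) (sym (lookup-index B∈)) (sym (lookup-index B′∈))
      (ss _ _ i≢j)))
    where
    fourCommon≰2 : ¬ 4 ≤ 2
    fourCommon≰2 (s≤s (s≤s ()))

  bit : ∀ {m} → Subset m → ℕ → Bool
  bit []      _       = false
  bit (s ∷ _) zero    = s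
  bit (_ ∷ S) (suc n) = bit S n

  ∈⇒bit : ∀ {m} (S : Subset m) i → i Subset.∈ S → bit S (toℕ i) ≡ true
  ∈⇒bit (_ ∷ _) F.zero    V.here       = refl
  ∈⇒bit (_ ∷ S) (F.suc i) (V.there i∈) = ∈⇒bit S i i∈

  Meets : ∀ {m} → Subset m → ℕ → Set
  Meets S k = bit S (double k) ≡ true ⊎ bit S (suc (double k)) ≡ true

  length-blocks≤ : ∀ Ts (S : Subset (length (blocks Ts))) → (∀ k → k < length Ts → Meets S k) →
    length (blocks Ts) ≤ 2 * ∣ S ∣
  length-blocks≤ []       S       meets = z≤n
  length-blocks≤ (T ∷ Ts) (s₀ ∷ s₁ ∷ S) meets = begin
    2 + length (blocks Ts)  ≤⟨ s≤s (s≤s (length-blocks≤ Ts S (λ k k<n → meets (suc k) (s≤s k<n)))) ⟩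
    2 + 2 * ∣ S ∣           ≡⟨ ℕP.*-suc 2 ∣ S ∣ ⟨
    2 * suc ∣ S ∣           ≤⟨ ℕP.*-monoʳ-≤ 2 (suc∣S∣≤ s₀ s₁ (meets zero (s≤s z≤n))) ⟩
    2 * ∣ s₀ ∷ s₁ ∷ S ∣     ∎
    where
    open ℕP.≤-Reasoning
    suc∣S∣≤ : ∀ s₀ s₁ → s₀ ≡ true ⊎ s₁ ≡ true → suc ∣ S ∣ ≤ ∣ s₀ ∷ s₁ ∷ S ∣
    suc∣S∣≤ true  true  _          = ℕP.n≤1+n _
    suc∣S∣≤ true  false _          = ℕP.≤-refl
    suc∣S∣≤ false true  _          = ℕP.≤-refl
    suc∣S∣≤ false false (inj₁ ())
    suc∣S∣≤ false false (inj₂ ())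

  missedTrade⇒⊥ : ∀ Ts → All IsTrade Ts → IsDD v (blocks Ts) → SuperSimple (blocks Ts) →
    ∀ S → IsDefiningSet v (blocks Ts) S → ∀ k → k < length Ts →
    bit S (double k) ≡ false → bit S (suc (double k)) ≡ false → ⊥
  missedTrade⇒⊥ Ts trades dd ss S defining k k<n e₀ e₁
    with B , B∈ , B′∈ , B-dist ← swapped-∈-swapTradeAt Ts k k<n (proj₁ dd) =
    superSimple⇒swap₀₁∉ ss B∈ B-dist
      (∈-resp-↭ (defining _ (isDD-swapTradeAt Ts trades dd k) S⊆ℬ′) B′∈)
    where
    missed : ∀ {n} → bit S n ≡ false → ∀ i → i Subset.∈ S → toℕ i ≢ n
    missed bit≡false i i∈S refl = contradiction (trans (sym (∈⇒bit S i i∈S)) bit≡false) λ ()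
    S⊆ℬ′ : ∀ i → i Subset.∈ S → L.lookup (blocks Ts) i ∈ blocks (swapTradeAt k Ts)
    S⊆ℬ′ i i∈S = ∈-swapTradeAt Ts k i (missed e₀ i i∈S) (missed e₁ i i∈S)

  definingSet-meets-trades : ∀ Ts → All IsTrade Ts → IsDD v (blocks Ts) → SuperSimple (blocks Ts) →
    ∀ S → IsDefiningSet v (blocks Ts) S → ∀ k → k < length Ts → Meets S k
  definingSet-meets-trades Ts trades dd ss S defining k k<n
    with bit S (double k) in e₀ | bit S (suc (double k)) in e₁
  ... | true  | _     = inj₁ refl
  ... | false | true  = inj₂ refl
  ... | false | false = ⊥-elim (missedTrade⇒⊥ Ts trades dd ss S defining k k<n e₀ e₁)

  defRatio-trades : ∀ Ts → All IsTrade Ts → IsDD v (blocks Ts) → SuperSimple (blocks Ts) →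
    DefRatioAtLeastHalf v (blocks Ts)
  defRatio-trades Ts trades dd ss S defining =
    length-blocks≤ Ts S (definingSet-meets-trades Ts trades dd ss S defining)

  FewCommon : Block v → Block v → Set
  FewCommon B C = commonPoints B C ≤ 2 × commonPoints C B ≤ 2

  allPairs⇒superSimple : ∀ {ℬ} → AllPairs FewCommon ℬ → SuperSimple ℬ
  allPairs⇒superSimple (_  ∷ _)  F.zero    F.zero    0≢0 = contradiction refl 0≢0
  allPairs⇒superSimple (fc ∷ _)  F.zero    (F.suc j) _   = proj₁ (All.lookup fc (∈-lookup j))
  allPairs⇒superSimple (fc ∷ _)  (F.suc i) F.zero    _   = proj₂ (All.lookup fc (∈-lookup i))
  allPairs⇒superSimple (_  ∷ fcs) (F.suc i) (F.suc j) i≢j = allPairs⇒superSimple fcs i j (i≢j ∘ cong F.suc)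

  Across : (Block v → Block v → Set) → Trade → Trade → Set
  Across R (B₀ , B₁) (C₀ , C₁) = R B₀ C₀ × R B₀ C₁ × R B₁ C₀ × R B₁ C₁

  allPairs-blocks : ∀ {R Ts} → All (λ (B , B′) → R B B′) Ts → AllPairs (Across R) Ts →
    AllPairs R (blocks Ts)
  allPairs-blocks []           []                 = []
  allPairs-blocks (r ∷ within) (across ∷ acrosses) =
    (r ∷ all-blocks (All.map (λ (r₀₀ , r₀₁ , _) → r₀₀ , r₀₁) across)) ∷
    all-blocks (All.map (λ (_ , _ , r₁₀ , r₁₁) → r₁₀ , r₁₁) across) ∷
    allPairs-blocks within acrosses

-- Cyclic designs

module Residues (v : ℕ) {{_ : NonZero v}} where

  infix 4 _≋_
  _≋_ : ℕ → ℕ → Set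
  m ≋ n = m % v ≡ n % v

  ≋-setoid : Setoid _ _
  ≋-setoid = On.setoid (setoid ℕ) (_% v)

  open import Relation.Binary.Reasoning.Setoid ≋-setoid

  %-≋ : ∀ m → m % v ≋ m
  %-≋ m = m%n%n≡m%n m v

  +v-≋ : ∀ m → m + v ≋ m
  +v-≋ m = [m+n]%n≡m%n m v

  ≋-+ʳ : ∀ {m n} w → m ≋ n → m + w ≋ n + w
  ≋-+ʳ {m} {n} w m≋n = trans (%-distribˡ-+ m w v)
    (trans (cong (λ r → (r + w % v) % v) m≋n) (sym (%-distribˡ-+ n w v)))

  ≋-+ˡ : ∀ {m n} w → m ≋ n → w + m ≋ w + n
  ≋-+ˡ {m} {n} w m≋n = subst₂ _≋_ (ℕP.+-comm m w) (ℕP.+-comm n w) (≋-+ʳ w m≋n)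

  ≋⇒≡ : ∀ {m n} → m < v → n < v → m ≋ n → m ≡ n
  ≋⇒≡ m<v n<v m≋n = trans (sym (m<n⇒m%n≡m m<v)) (trans m≋n (m<n⇒m%n≡m n<v))

  -- b − a modulo v; since v ∸ a truncates, only meaningful for a ≤ v.
  diff : ℕ → ℕ → ℕ
  diff a b = (b + (v ∸ a)) % v

  diff<v : ∀ a b → diff a b < v
  diff<v a b = m%n<n (b + (v ∸ a)) v

  +diff≋ : ∀ {a} b → a ≤ v → a + diff a b ≋ b
  +diff≋ {a} b a≤v = begin
    a + diff a b        ≈⟨ ≋-+ˡ a (%-≋ (b + (v ∸ a))) ⟩
    a + (b + (v ∸ a))   ≡⟨ x∙yz≈y∙xz a b (v ∸ a) ⟩
    b + (a + (v ∸ a))   ≡⟨ cong (b +_) (ℕP.m+[n∸m]≡n a≤v) ⟩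
    b + v               ≈⟨ +v-≋ b ⟩
    b                   ∎

  +≋⇒≋diff : ∀ {a d b} → a ≤ v → a + d ≋ b → d ≋ diff a b
  +≋⇒≋diff {a} {d} {b} a≤v a+d≋b = begin
    d                   ≈⟨ +v-≋ d ⟨
    d + v               ≡⟨ cong (d +_) (ℕP.m+[n∸m]≡n a≤v) ⟨
    d + (a + (v ∸ a))   ≡⟨ x∙yz≈y∙xz d a (v ∸ a) ⟩
    a + (d + (v ∸ a))   ≡⟨ ℕP.+-assoc a d (v ∸ a) ⟨
    a + d + (v ∸ a)     ≈⟨ ≋-+ʳ (v ∸ a) a+d≋b ⟩
    b + (v ∸ a)         ≈⟨ %-≋ (b + (v ∸ a)) ⟨
    diff a b            ∎

  ≋-cancelˡ : ∀ {a m n} → a ≤ v → a + m ≋ a + n → m ≋ n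
  ≋-cancelˡ a≤v a+m≋a+n = trans (+≋⇒≋diff a≤v a+m≋a+n) (sym (+≋⇒≋diff a≤v refl))

  ≋-cancelʳ : ∀ {m n} w → m + w ≋ n + w → m ≋ n
  ≋-cancelʳ {m} {n} w m+w≋n+w = ≋-cancelˡ (ℕP.<⇒≤ (m%n<n w v)) (begin
    w % v + m   ≡⟨ ℕP.+-comm (w % v) m ⟩
    m + w % v   ≈⟨ ≋-+ˡ m (%-≋ w) ⟩
    m + w       ≈⟨ m+w≋n+w ⟩
    n + w       ≈⟨ ≋-+ˡ n (%-≋ w) ⟨
    n + w % v   ≡⟨ ℕP.+-comm n (w % v) ⟩
    w % v + n   ∎)

  diff≡0⇒≡ : ∀ {a b} → a < v → b < v → diff a b ≡ 0 → a ≡ b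
  diff≡0⇒≡ {a} {b} a<v b<v diff≡0 = ≋⇒≡ a<v b<v (begin
    a              ≡⟨ ℕP.+-identityʳ a ⟨
    a + 0          ≡⟨ cong (a +_) diff≡0 ⟨
    a + diff a b   ≈⟨ +diff≋ b (ℕP.<⇒≤ a<v) ⟩
    b              ∎)

  ≡mod⇒≋ : ∀ {x : Fin v} {n} → x ≡ n mod v → toℕ x ≋ n
  ≡mod⇒≋ {n = n} refl = begin
    toℕ (n mod v)   ≡⟨ FP.toℕ-fromℕ< (m%n<n n v) ⟩
    n % v           ≈⟨ %-≋ n ⟩
    n               ∎

  ≋⇒≡mod : ∀ {x : Fin v} {n} → toℕ x ≋ n → x ≡ n mod v
  ≋⇒≡mod {x} {n} x≋n = FP.toℕ-injective
    (trans (≋⇒≡ (FP.toℕ<n x) (m%n<n n v) (trans x≋n (sym (%-≋ n)))) (sym (FP.toℕ-fromℕ< (m%n<n n v))))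

  mod≡mod⇒≋ : ∀ {m n} → m mod v ≡ n mod v → m ≋ n
  mod≡mod⇒≋ {m} {n} eq = trans (sym (≡mod⇒≋ {m mod v} refl)) (≡mod⇒≋ eq)

module Cyclic (v : ℕ) {{_ : NonZero v}} where

  open Residues v
  open Trades {v}
  open Occurrences ℕ._≟_ using (occ; occ-++; occ≡0⊎∈)
  open import Data.List.Membership.DecPropositional (F._≟_ {v}) using () renaming (_∈?_ to _∈ᶠ?_)
  module PairOcc = Occurrences _≟ₚ_
  module FinOcc = Occurrences (F._≟_ {v})

  Base : Set
  Base = Vec ℕ 4

  infixl 6 _⊕_
  _⊕_ : Base → ℕ → Block v
  X ⊕ t = V.map (λ a → (a + t) mod v) X

  ValidBase : Base → Set
  ValidBase X = VAll.All (_< v) X × Distinct X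

  translate-injective : ∀ {a b} t → a < v → b < v → (a + t) mod v ≡ (b + t) mod v → a ≡ b
  translate-injective t a<v b<v eq = ≋⇒≡ a<v b<v (≋-cancelʳ t (mod≡mod⇒≋ eq))

  distinct-⊕ : ∀ {X} → ValidBase X → ∀ t → Distinct (X ⊕ t)
  distinct-⊕ {X} (X<v , X-dist) t i j i≢j eq = X-dist i j i≢j
    (translate-injective t (VAllP.lookup⁺ X<v i) (VAllP.lookup⁺ X<v j)
      (trans (sym (VP.lookup-map i _ X)) (trans eq (VP.lookup-map j _ X))))

  translatePair : ℕ → ℕ × ℕ → Fin v × Fin v
  translatePair t (a , b) = (a + t) mod v , (b + t) mod v

  basePairs : Base → List (ℕ × ℕ)
  basePairs (a ∷ b ∷ c ∷ d ∷ []) = (a , b) ∷ (a , c) ∷ (a , d) ∷ (b , c) ∷ (b , d) ∷ (c , d) ∷ []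

  differences : Base → List ℕ
  differences X = L.map (uncurry diff) (basePairs X)

  δ : Fin v → Fin v → ℕ
  δ x y = diff (toℕ x) (toℕ y)

  hits-⊕ : ∀ x y {X} → ValidBase X → ∀ t →
    hits x y (X ⊕ t) ≡ PairOcc.occ (x , y) (L.map (translatePair t) (basePairs X))
  hits-⊕ x y {_ ∷ _ ∷ _ ∷ _ ∷ []} valid t =
    PairOcc.𝟙∈≡occ (x , y) (orderedPairs-unique (distinct-⊕ valid t))

  -- Exactly one translate t < v sends a to x, namely t₀ = x − a; it sends b to y iff y − x = b − a.
  ∑-translatePair : ∀ x y {a} b → a < v →
    ∑[ t < v ] 𝟙 ((x , y) ≟ₚ translatePair t (a , b)) ≡ 𝟙 (δ x y ℕ.≟ diff a b)
  ∑-translatePair x y {a} b a<v = trans (∑-single v (diff<v a X) off-t₀)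
    (𝟙-cong (forward ∘ cong proj₂) (cong₂ _,_ x≡a+t₀ ∘ backward)
            ((x , y) ≟ₚ translatePair t₀ (a , b)) (δ x y ℕ.≟ d))
    where
    X = toℕ x
    Y = toℕ y
    t₀ = diff a X
    d = diff a b
    a≤v = ℕP.<⇒≤ a<v
    X≤v = ℕP.<⇒≤ (FP.toℕ<n x)
    x≡a+t₀ : x ≡ (a + t₀) mod v
    x≡a+t₀ = ≋⇒≡mod (sym (+diff≋ X a≤v))
    off-t₀ : ∀ t → t < v → t ≢ t₀ → 𝟙 ((x , y) ≟ₚ translatePair t (a , b)) ≡ 0
    off-t₀ t t<v t≢t₀ = 𝟙-no ((x , y) ≟ₚ translatePair t (a , b)) λ eq →
      t≢t₀ (≋⇒≡ t<v (diff<v a X) (+≋⇒≋diff a≤v (sym (≡mod⇒≋ (cong proj₁ eq)))))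
    b+t₀≋X+d : b + t₀ ≋ X + d
    b+t₀≋X+d = begin
      b + t₀          ≈⟨ ≋-+ʳ t₀ (+diff≋ b a≤v) ⟨
      a + d + t₀      ≡⟨ xy∙z≈y∙xz a d t₀ ⟩
      d + (a + t₀)    ≈⟨ ≋-+ˡ d (+diff≋ X a≤v) ⟩
      d + X           ≡⟨ ℕP.+-comm d X ⟩
      X + d           ∎
      where open import Relation.Binary.Reasoning.Setoid ≋-setoid
    forward : y ≡ (b + t₀) mod v → δ x y ≡ d
    forward y≡b+t₀ =
      sym (≋⇒≡ (diff<v a b) (diff<v X Y) (+≋⇒≋diff X≤v (sym (trans (≡mod⇒≋ y≡b+t₀) b+t₀≋X+d))))
    backward : δ x y ≡ d → y ≡ (b + t₀) mod v
    backward δ≡d =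
      ≋⇒≡mod (trans (sym (+diff≋ Y X≤v)) (trans (cong (λ e → (X + e) % v) δ≡d) (sym b+t₀≋X+d)))

  ∑-translatePairs : ∀ x y ps → All ((_< v) ∘ proj₁) ps →
    ∑[ t < v ] PairOcc.occ (x , y) (L.map (translatePair t) ps) ≡ occ (δ x y) (L.map (uncurry diff) ps)
  ∑-translatePairs x y []             []           = ∑-zero v (λ _ _ → refl)
  ∑-translatePairs x y ((a , b) ∷ ps) (a<v ∷ ps<v) =
    trans (∑-distrib-+ v (λ t → 𝟙 ((x , y) ≟ₚ translatePair t (a , b)))
                         (λ t → PairOcc.occ (x , y) (L.map (translatePair t) ps)))
      (cong₂ _+_ (∑-translatePair x y b a<v) (∑-translatePairs x y ps ps<v))

  ∑-hits-⊕ : ∀ x y {X} → ValidBase X → ∑[ t < v ] hits x y (X ⊕ t) ≡ occ (δ x y) (differences X)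
  ∑-hits-⊕ x y {X@(_ ∷ _ ∷ _ ∷ _ ∷ [])} valid@(a<v ∷ b<v ∷ c<v ∷ _ ∷ [] , _) =
    trans (∑-cong v (hits-⊕ x y valid))
      (∑-translatePairs x y (basePairs X) (a<v ∷ a<v ∷ a<v ∷ b<v ∷ b<v ∷ c<v ∷ []))

  ValidTrade : Base × Base → Set
  ValidTrade (P , Q) = ValidBase P × ValidBase Q

  development : Base × Base → List Trade
  development (P , Q) = applyUpTo (λ t → P ⊕ t , Q ⊕ t) v

  design : List (Base × Base) → List Trade
  design = concatMap development

  designDifferences : List (Base × Base) → List ℕ
  designDifferences = concatMap (λ (P , Q) → differences P ++ differences Q)

  all-design : ∀ {ℓ} {Pr : Trade → Set ℓ} PQs →
    All (λ (P , Q) → ∀ {t} → t < v → Pr (P ⊕ t , Q ⊕ t)) PQs → All Pr (design PQs)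
  all-design PQs pr = AllP.concat⁺ (AllP.map⁺ (All.map (AllP.applyUpTo⁺₁ _ v) pr))

  pairCount-blocks-applyUpTo : ∀ x y n (T : ℕ → Trade) →
    pairCount x y (blocks (applyUpTo T n)) ≡ ∑[ t < n ] (hits x y (proj₁ (T t)) + hits x y (proj₂ (T t)))
  pairCount-blocks-applyUpTo x y zero    T = refl
  pairCount-blocks-applyUpTo x y (suc n) T =
    trans (pairCount-blocks-∷ x y (proj₁ (T 0)) (proj₂ (T 0)) (applyUpTo (T ∘ suc) n))
    (cong (hits x y (proj₁ (T 0)) + hits x y (proj₂ (T 0)) +_) (pairCount-blocks-applyUpTo x y n (T ∘ suc)))

  pairCount-design : ∀ x y PQs → All ValidTrade PQs →
    pairCount x y (blocks (design PQs)) ≡ occ (δ x y) (designDifferences PQs)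
  pairCount-design x y []             []                    = refl
  pairCount-design x y ((P , Q) ∷ PQs) ((P-valid , Q-valid) ∷ valid) = begin
    pairCount x y (blocks (development (P , Q) ++ design PQs))
      ≡⟨ cong (pairCount x y) (blocks-++ (development (P , Q)) (design PQs)) ⟩
    pairCount x y (blocks (development (P , Q)) ++ blocks (design PQs))
      ≡⟨ pairCount-++ x y (blocks (development (P , Q))) _ ⟩
    pairCount x y (blocks (development (P , Q))) + pairCount x y (blocks (design PQs))
      ≡⟨ cong₂ _+_ (pairCount-blocks-applyUpTo x y v _) (pairCount-design x y PQs valid) ⟩
    ∑[ t < v ] (hits x y (P ⊕ t) + hits x y (Q ⊕ t)) + occ u rest
      ≡⟨ cong (_+ occ u rest) (∑-distrib-+ v (λ t → hits x y (P ⊕ t)) (λ t → hits x y (Q ⊕ t))) ⟩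
    (∑[ t < v ] hits x y (P ⊕ t) + ∑[ t < v ] hits x y (Q ⊕ t)) + occ u rest
      ≡⟨ cong (λ n → n + occ u rest) (cong₂ _+_ (∑-hits-⊕ x y P-valid) (∑-hits-⊕ x y Q-valid)) ⟩
    (occ u (differences P) + occ u (differences Q)) + occ u rest
      ≡⟨ cong (_+ occ u rest) (occ-++ u (differences P) (differences Q)) ⟨
    occ u (differences P ++ differences Q) + occ u rest
      ≡⟨ occ-++ u (differences P ++ differences Q) rest ⟨
    occ u (designDifferences ((P , Q) ∷ PQs)) ∎
    where
    open ≡-Reasoning
    u = δ x y
    rest = designDifferences PQs

  DifferenceFamily : List ℕ → Set
  DifferenceFamily D = All (λ e → e ≢ 0 → occ e D ≡ 2) (upTo v)

  δ≢0 : ∀ {x y} → x ≢ y → δ x y ≢ 0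
  δ≢0 {x} {y} x≢y δ≡0 = x≢y (FP.toℕ-injective (diff≡0⇒≡ (FP.toℕ<n x) (FP.toℕ<n y) δ≡0))

  isDD-design : ∀ PQs → All ValidTrade PQs → DifferenceFamily (designDifferences PQs) →
    IsDD v (blocks (design PQs))
  isDD-design PQs valid family =
    all-blocks (all-design PQs
      (All.map (λ (P-valid , Q-valid) {t} _ → distinct-⊕ P-valid t , distinct-⊕ Q-valid t) valid)) ,
    λ x y x≢y → trans (pairCount-design x y PQs valid)
      (All.lookup family (∈-upTo⁺ (diff<v (toℕ x) (toℕ y))) (δ≢0 x≢y))

  crossDifferences : Base → Base → List ℕ
  crossDifferences X Y = concatMap (λ a → L.map (λ p → diff p a) (toList Y)) (toList X)

  common⇒diff : ∀ {a p t t′} → p ≤ v → t ≤ v → (a + t) mod v ≡ (p + t′) mod v →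
    diff t t′ ≡ diff p a
  common⇒diff {a} {p} {t} {t′} p≤v t≤v eq =
    ≋⇒≡ (diff<v t t′) (diff<v p a) (sym (+≋⇒≋diff t≤v t+[a−p]≋t′))
    where
    open import Relation.Binary.Reasoning.Setoid ≋-setoid
    t+[a−p]≋t′ : t + diff p a ≋ t′
    t+[a−p]≋t′ = ≋-cancelˡ p≤v (begin
      p + (t + diff p a)   ≡⟨ x∙yz≈y∙xz p t (diff p a) ⟩
      t + (p + diff p a)   ≈⟨ ≋-+ˡ t (+diff≋ a p≤v) ⟩
      t + a                ≡⟨ ℕP.+-comm t a ⟩
      a + t                ≈⟨ mod≡mod⇒≋ eq ⟩
      p + t′               ∎)

  occ-translates≤ : ∀ {a t t′} ys → All (_≤ v) ys → t ≤ v →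
    FinOcc.occ ((a + t) mod v) (L.map (λ p → (p + t′) mod v) ys) ≤
    occ (diff t t′) (L.map (λ p → diff p a) ys)
  occ-translates≤                []       []           t≤v = z≤n
  occ-translates≤ {a} {t} {t′} (p ∷ ys) (p≤v ∷ ys≤v) t≤v =
    ℕP.+-mono-≤
      (𝟙-mono (common⇒diff p≤v t≤v) ((a + t) mod v F.≟ (p + t′) mod v) (diff t t′ ℕ.≟ diff p a))
      (occ-translates≤ ys ys≤v t≤v)

  commonPoints-translates≤ : ∀ {t t′} xs ys → All (_≤ v) ys → t ≤ v →
    length (filter (_∈ᶠ? L.map (λ p → (p + t′) mod v) ys) (L.map (λ a → (a + t) mod v) xs))
      ≤ occ (diff t t′) (concatMap (λ a → L.map (λ p → diff p a) ys) xs)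
  commonPoints-translates≤         []       ys ys≤v t≤v = z≤n
  commonPoints-translates≤ {t} {t′} (a ∷ xs) ys ys≤v t≤v = begin
    length (filter P? (L.map f (a ∷ xs)))
      ≡⟨ length-filter-∷ P? (f a) (L.map f xs) ⟩
    𝟙 (P? (f a)) + length (filter P? (L.map f xs))
      ≤⟨ ℕP.+-mono-≤ (ℕP.≤-trans (FinOcc.𝟙∈≤occ (f a) (L.map g ys)) (occ-translates≤ ys ys≤v t≤v))
                     (commonPoints-translates≤ xs ys ys≤v t≤v) ⟩
    occ u (L.map (λ p → diff p a) ys) + occ u (concatMap (λ a → L.map (λ p → diff p a) ys) xs)
      ≡⟨ occ-++ u (L.map (λ p → diff p a) ys) _ ⟨
    occ u (concatMap (λ a → L.map (λ p → diff p a) ys) (a ∷ xs)) ∎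
    where
    open ℕP.≤-Reasoning
    f = λ a → (a + t) mod v
    g = λ p → (p + t′) mod v
    P? = _∈ᶠ? L.map g ys
    u = diff t t′

  commonPoints-⊕≤ : ∀ X {Y} → ValidBase Y → ∀ {t} t′ → t ≤ v →
    commonPoints (X ⊕ t) (Y ⊕ t′) ≤ occ (diff t t′) (crossDifferences X Y)
  commonPoints-⊕≤ (a ∷ b ∷ c ∷ d ∷ []) {p ∷ q ∷ r ∷ s ∷ []} (p<v ∷ q<v ∷ r<v ∷ s<v ∷ [] , _)
    t′ t≤v =
    commonPoints-translates≤ (a ∷ b ∷ c ∷ d ∷ []) (p ∷ q ∷ r ∷ s ∷ [])
      (ℕP.<⇒≤ p<v ∷ ℕP.<⇒≤ q<v ∷ ℕP.<⇒≤ r<v ∷ ℕP.<⇒≤ s<v ∷ []) t≤v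

  AtMostTwice : List ℕ → Set
  AtMostTwice D = All (λ e → occ e D ≤ 2) D

  NonzeroAtMostTwice : List ℕ → Set
  NonzeroAtMostTwice D = All (λ e → e ≢ 0 → occ e D ≤ 2) D

  occ≤2 : ∀ {D} → AtMostTwice D → ∀ u → occ u D ≤ 2
  occ≤2 {D} twice u with occ≡0⊎∈ u D
  ... | inj₁ occ≡0 = ℕP.≤-trans (ℕP.≤-reflexive occ≡0) z≤n
  ... | inj₂ u∈D   = All.lookup twice u∈D

  occ≤2-nonzero : ∀ {D} → NonzeroAtMostTwice D → ∀ u → u ≢ 0 → occ u D ≤ 2
  occ≤2-nonzero {D} twice u u≢0 with occ≡0⊎∈ u D
  ... | inj₁ occ≡0 = ℕP.≤-trans (ℕP.≤-reflexive occ≡0) z≤n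
  ... | inj₂ u∈D   = All.lookup twice u∈D u≢0

  Compatible : Base → Base → Set
  Compatible X Y = AtMostTwice (crossDifferences X Y) × AtMostTwice (crossDifferences Y X)

  SelfCompatible : Base → Set
  SelfCompatible X = NonzeroAtMostTwice (crossDifferences X X)

  fewCommon-⊕ : ∀ {X Y} → ValidBase X → ValidBase Y → Compatible X Y →
    ∀ {t t′} → t < v → t′ < v → FewCommon (X ⊕ t) (Y ⊕ t′)
  fewCommon-⊕ {X} {Y} X-valid Y-valid (XY , YX) {t} {t′} t<v t′<v =
    ℕP.≤-trans (commonPoints-⊕≤ X Y-valid t′ (ℕP.<⇒≤ t<v)) (occ≤2 XY (diff t t′)) ,
    ℕP.≤-trans (commonPoints-⊕≤ Y X-valid t (ℕP.<⇒≤ t′<v)) (occ≤2 YX (diff t′ t))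

  fewCommon-⊕-self : ∀ {X} → ValidBase X → SelfCompatible X →
    ∀ {t t′} → t < v → t′ < v → t ≢ t′ → FewCommon (X ⊕ t) (X ⊕ t′)
  fewCommon-⊕-self {X} X-valid XX {t} {t′} t<v t′<v t≢t′ =
    ℕP.≤-trans (commonPoints-⊕≤ X X-valid t′ (ℕP.<⇒≤ t<v))
      (occ≤2-nonzero XX (diff t t′) (t≢t′ ∘ diff≡0⇒≡ t<v t′<v)) ,
    ℕP.≤-trans (commonPoints-⊕≤ X X-valid t (ℕP.<⇒≤ t′<v))
      (occ≤2-nonzero XX (diff t′ t) (t≢t′ ∘ sym ∘ diff≡0⇒≡ t′<v t<v))

  TradeCompatible : Base × Base → Set
  TradeCompatible (P , Q) = SelfCompatible P × SelfCompatible Q × Compatible P Q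

  TradesCompatible : Base × Base → Base × Base → Set
  TradesCompatible (P , Q) (P′ , Q′) =
    Compatible P P′ × Compatible P Q′ × Compatible Q P′ × Compatible Q Q′

  allPairs-development : ∀ {PQ} → ValidTrade PQ → TradeCompatible PQ →
    AllPairs (Across FewCommon) (development PQ)
  allPairs-development (P-valid , Q-valid) (PP , QQ , PQ) = AllPairsP.applyUpTo⁺₁ _ v λ i<j j<v →
    let i<v = ℕP.<-trans i<j j<v ; i≢j = ℕP.<⇒≢ i<j in
    fewCommon-⊕-self P-valid PP i<v j<v i≢j , fewCommon-⊕ P-valid Q-valid PQ i<v j<v ,
    fewCommon-⊕ Q-valid P-valid (swap PQ) i<v j<v , fewCommon-⊕-self Q-valid QQ i<v j<v i≢j

  across-design : ∀ {P Q t} → ValidTrade (P , Q) → t < v → ∀ PQs → All ValidTrade PQs →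
    All (TradesCompatible (P , Q)) PQs → All (Across FewCommon (P ⊕ t , Q ⊕ t)) (design PQs)
  across-design (P-valid , Q-valid) t<v PQs valid compatible = all-design PQs (All.zipWith
    (λ ((P′-valid , Q′-valid) , (PP′ , PQ′ , QP′ , QQ′)) {_} t′<v →
      fewCommon-⊕ P-valid P′-valid PP′ t<v t′<v , fewCommon-⊕ P-valid Q′-valid PQ′ t<v t′<v ,
      fewCommon-⊕ Q-valid P′-valid QP′ t<v t′<v , fewCommon-⊕ Q-valid Q′-valid QQ′ t<v t′<v)
    (valid , compatible))

  allPairs-design : ∀ PQs → All ValidTrade PQs → All TradeCompatible PQs → AllPairs TradesCompatible PQs →
    AllPairs (Across FewCommon) (design PQs)
  allPairs-design []         []             []             []                   = []
  allPairs-design (PQ ∷ PQs) (PQ-valid ∷ valid) (PQ-compat ∷ compat) (PQ-across ∷ pairwise) =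
    AllPairsP.++⁺ (allPairs-development PQ-valid PQ-compat) (allPairs-design PQs valid compat pairwise)
      (AllP.applyUpTo⁺₁ _ v λ t<v → across-design PQ-valid t<v PQs valid PQ-across)

  superSimple-design : ∀ PQs → All ValidTrade PQs → All TradeCompatible PQs → AllPairs TradesCompatible PQs →
    SuperSimple (blocks (design PQs))
  superSimple-design PQs valid compat pairwise = allPairs⇒superSimple (allPairs-blocks
    (all-design PQs (All.zipWith
      (λ ((P-valid , Q-valid) , (_ , _ , PQ)) {_} t<v → fewCommon-⊕ P-valid Q-valid PQ t<v t<v)
      (valid , compat)))
    (allPairs-design PQs valid compat pairwise))

  validBase? : (X : Base) → Dec (ValidBase X)
  validBase? X = VAll.all? (ℕ._<? v) X ×-dec distinct? ℕ._≟_ X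

  validTrade? : (PQ : Base × Base) → Dec (ValidTrade PQ)
  validTrade? (P , Q) = validBase? P ×-dec validBase? Q

  differenceFamily? : (D : List ℕ) → Dec (DifferenceFamily D)
  differenceFamily? D = All.all? (λ e → ¬? (e ℕ.≟ 0) →-dec occ e D ℕ.≟ 2) (upTo v)

  atMostTwice? : (D : List ℕ) → Dec (AtMostTwice D)
  atMostTwice? D = All.all? (λ e → occ e D ℕ.≤? 2) D

  nonzeroAtMostTwice? : (D : List ℕ) → Dec (NonzeroAtMostTwice D)
  nonzeroAtMostTwice? D = All.all? (λ e → ¬? (e ℕ.≟ 0) →-dec occ e D ℕ.≤? 2) D

  compatible? : (X Y : Base) → Dec (Compatible X Y)
  compatible? X Y = atMostTwice? (crossDifferences X Y) ×-dec atMostTwice? (crossDifferences Y X)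

  tradeCompatible? : (PQ : Base × Base) → Dec (TradeCompatible PQ)
  tradeCompatible? (P , Q) =
    nonzeroAtMostTwice? (crossDifferences P P) ×-dec nonzeroAtMostTwice? (crossDifferences Q Q) ×-dec
    compatible? P Q

  tradesCompatible? : (PQ PQ′ : Base × Base) → Dec (TradesCompatible PQ PQ′)
  tradesCompatible? (P , Q) (P′ , Q′) =
    compatible? P P′ ×-dec compatible? P Q′ ×-dec compatible? Q P′ ×-dec compatible? Q Q′

  Certified : List (Base × Base) → Set
  Certified PQs = All ValidTrade PQs × DifferenceFamily (designDifferences PQs) ×
                  All TradeCompatible PQs × AllPairs TradesCompatible PQs

  certified? : (PQs : List (Base × Base)) → Dec (Certified PQs)
  certified? PQs = All.all? validTrade? PQs ×-dec differenceFamily? (designDifferences PQs) ×-dec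
                   All.all? tradeCompatible? PQs ×-dec AllPairs.allPairs? tradesCompatible? PQs

  tradeBases : ℕ × ℕ × ℕ × ℕ × ℕ → Base × Base
  tradeBases (d , p , q , r , s) = (0 ∷ d ∷ p ∷ q ∷ []) , (d ∷ 0 ∷ r ∷ s ∷ [])

  isTrade-design : ∀ seeds → All IsTrade (design (L.map tradeBases seeds))
  isTrade-design seeds =
    all-design _ (AllP.map⁺ {f = tradeBases} (All.universal (λ _ {_} _ → refl , refl) seeds))

  cyclicDesign : ∀ seeds → True (certified? (L.map tradeBases seeds)) →
    ∃[ ℬ ] (IsDD v ℬ × SuperSimple ℬ × DefRatioAtLeastHalf v ℬ)
  cyclicDesign seeds certificate =
    let valid , family , compatible , pairwise = toWitness certificate
        dd = isDD-design PQs valid family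
        ss = superSimple-design PQs valid compatible pairwise
    in blocks (design PQs) , dd , ss , defRatio-trades (design PQs) (isTrade-design seeds) dd ss
    where PQs = L.map tradeBases seeds

-- The designs for v ∈ {49, 61, 73, 97, 121}

seeds49 : List (ℕ × ℕ × ℕ × ℕ × ℕ)
seeds49 =
  (1 , 11 , 28 , 39 , 22)
  ∷ (1 , 5 , 43 , 45 , 7)
  ∷ (2 , 8 , 44 , 43 , 7)
  ∷ (2 , 14 , 32 , 37 , 19)
  ∷ (3 , 23 , 37 , 29 , 15)
  ∷ (3 , 31 , 22 , 21 , 30)
  ∷ (4 , 13 , 29 , 40 , 24)
  ∷ (8 , 34 , 24 , 23 , 33) ∷ []

seeds61 : List (ℕ × ℕ × ℕ × ℕ × ℕ)
seeds61 =
  (1 , 35 , 51 , 27 , 11)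
  ∷ (1 , 46 , 29 , 16 , 33)
  ∷ (2 , 53 , 35 , 10 , 28)
  ∷ (2 , 57 , 44 , 6 , 19)
  ∷ (3 , 24 , 49 , 40 , 15)
  ∷ (3 , 7 , 37 , 57 , 27)
  ∷ (5 , 12 , 23 , 54 , 43)
  ∷ (5 , 19 , 41 , 47 , 25)
  ∷ (6 , 47 , 38 , 20 , 29)
  ∷ (8 , 48 , 39 , 21 , 30) ∷ []

seeds73 : List (ℕ × ℕ × ℕ × ℕ × ℕ)
seeds73 =
  (1 , 55 , 47 , 19 , 27)
  ∷ (1 , 25 , 44 , 49 , 30)
  ∷ (2 , 38 , 42 , 37 , 33)
  ∷ (2 , 12 , 29 , 63 , 46)
  ∷ (3 , 37 , 15 , 39 , 61)
  ∷ (3 , 10 , 31 , 66 , 45)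
  ∷ (4 , 34 , 57 , 43 , 20)
  ∷ (5 , 11 , 25 , 67 , 53)
  ∷ (5 , 14 , 52 , 64 , 26)
  ∷ (6 , 57 , 66 , 22 , 13)
  ∷ (8 , 23 , 41 , 58 , 40)
  ∷ (11 , 24 , 56 , 60 , 28) ∷ []

seeds97 : List (ℕ × ℕ × ℕ × ℕ × ℕ)
seeds97 =
  (1 , 74 , 40 , 24 , 58)
  ∷ (1 , 50 , 76 , 48 , 22)
  ∷ (2 , 59 , 50 , 40 , 49)
  ∷ (2 , 72 , 77 , 27 , 22)
  ∷ (3 , 64 , 8 , 36 , 92)
  ∷ (3 , 85 , 81 , 15 , 19)
  ∷ (4 , 63 , 11 , 38 , 90)
  ∷ (6 , 32 , 60 , 71 , 43)
  ∷ (6 , 68 , 13 , 35 , 90)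
  ∷ (8 , 86 , 68 , 19 , 37)
  ∷ (9 , 27 , 44 , 79 , 62)
  ∷ (10 , 76 , 56 , 31 , 51)
  ∷ (10 , 54 , 84 , 53 , 23)
  ∷ (12 , 36 , 64 , 73 , 45)
  ∷ (14 , 72 , 30 , 39 , 81)
  ∷ (14 , 31 , 46 , 80 , 65) ∷ []

seeds121 : List (ℕ × ℕ × ℕ × ℕ × ℕ)
seeds121 =
  (57 , 24 , 58 , 33 , 120)
  ∷ (50 , 53 , 72 , 118 , 99)
  ∷ (64 , 55 , 26 , 9 , 38)
  ∷ (78 , 44 , 71 , 34 , 7)
  ∷ (40 , 21 , 29 , 19 , 11)
  ∷ (83 , 82 , 10 , 1 , 73)
  ∷ (30 , 7 , 4 , 23 , 26)
  ∷ (78 , 9 , 109 , 69 , 90)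
  ∷ (27 , 85 , 113 , 63 , 35)
  ∷ (24 , 105 , 37 , 40 , 108)
  ∷ (86 , 12 , 88 , 74 , 119)
  ∷ (6 , 105 , 20 , 22 , 107)
  ∷ (18 , 73 , 60 , 66 , 79)
  ∷ (77 , 23 , 82 , 54 , 116)
  ∷ (11 , 80 , 15 , 52 , 117)
  ∷ (104 , 30 , 119 , 74 , 106)
  ∷ (70 , 115 , 90 , 76 , 101)
  ∷ (103 , 28 , 89 , 75 , 14)
  ∷ (37 , 62 , 104 , 96 , 54)
  ∷ (5 , 56 , 46 , 70 , 80) ∷ []


lemma7 : ∀ (v : ℕ) → v ∈ (49 ∷ 61 ∷ 73 ∷ 97 ∷ 121 ∷ []) →
    ∃[ ℬ ] (IsDD v ℬ × SuperSimple ℬ × DefRatioAtLeastHalf v ℬ)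
lemma7 v (here refl)                                 = Cyclic.cyclicDesign 49 seeds49 _
lemma7 v (there (here refl))                         = Cyclic.cyclicDesign 61 seeds61 _
lemma7 v (there (there (here refl)))                 = Cyclic.cyclicDesign 73 seeds73 _
lemma7 v (there (there (there (here refl))))         = Cyclic.cyclicDesign 97 seeds97 _
lemma7 v (there (there (there (there (here refl))))) = Cyclic.cyclicDesign 121 seeds121 _
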